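{- Let $m$ be an odd positive integer with $m = 2n-1$, $n \ge 2$, and write $m = 2^p(2q+1) - 1$ with $p \ge 1$, $q \ge 0$. The following are equivalent: (1) $T^p(m) \equiv 2 \pmod 4$; (2) $p$ and $q$ have opposite parities; (3) $C(n) = 0$.
   Context: $T:\mathbb{Z}^+\to\mathbb{Z}^+$ is defined by $T(x) = x/2$ if $x$ is even and $T(x) = (3x+1)/2$ if $x$ is odd; $T^k$ denotes the $k$-fold iterate. The function $C:\mathbb{Z}^+\to\{0,1\}$ is defined recursively by $C(1) = 0$, $C(n) = 1 - C(n-2)$ if $n > 1$ is odd, and $C(n) = 1 - C(n/2)$ if $n$ is even. -}

module Defs where

open import Data.Nat using (ℕ; zero; suc; _+_; _*_; _∸_; _%_)

half : ℕ → ℕ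
half zero = zero
half (suc zero) = zero
half (suc (suc n)) = suc (half n)

T : ℕ → ℕ
T x with x % 2
... | zero = half x
... | suc _ = half (3 * x + 1)

iterT : ℕ → ℕ → ℕ
iterT zero x = x
iterT (suc k) x = T (iterT k x)

-- C(1) = 0, C(n) = 1 - C(n-2) for odd n > 1, C(n) = 1 - C(n/2) for even n.
-- Defined by recursion on a fuel argument; fuel ≥ n always suffices since
-- each recursive call strictly decreases n (n-2 < n, n/2 < n for n ≥ 1).
-- C 0 is junk (C is only meaningful on positive integers).
Cf : ℕ → ℕ → ℕ
Cf zero n = zero
Cf (suc f) zero = zero
Cf (suc f) (suc zero) = zero
Cf (suc f) (suc (suc k)) with k % 2
... | zero = 1 ∸ Cf f (half (suc (suc k)))
... | suc _ = 1 ∸ Cf f k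

C : ℕ → ℕ
C n = Cf n n

{-# OPTIONS --safe #-}
-- If x + 1 = 2y then T x + 1 = 3y, so the p-fold iterate turns m + 1 = 2^p (2q+1) into
-- T^p m + 1 = 3^p (2q+1). As 3 ≡ -1 (mod 4), the right side is ≡ (-1)^(p+q), hence
-- T^p m ≡ 2 (mod 4) exactly when p + q is odd. On the other side C flips under doubling and
-- under n ↦ n + 2 on odd numbers, so C (2^j (2q+1)) = (j + q) mod 2; for
-- n = 2^(p-1) (2q+1) this says C n = 0 exactly when p + q is odd.
module Submission where

open import Defs
open import Data.Nat using (ℕ; zero; suc; _+_; _*_; _^_; _%_; _≥_; _≤_; _∸_; z≤n; s≤s; NonZero)
open import Data.Nat.Properties
open import Data.Nat.DivMod using ([m+kn]%n≡m%n; m%n*o≡m*o%[n*o]; m*n%n≡0)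
open import Data.Nat.Tactic.RingSolver using (solve-∀)
open import Relation.Binary.PropositionalEquality
open import Data.Product using (_×_; _,_)
open import Data.Empty using (⊥-elim)
open import Function.Bundles using (_⇔_; mk⇔)
open import Function.Construct.Composition using (_⇔-∘_)
open import Function.Construct.Symmetry using (⇔-sym)
open import Algebra.Properties.CommutativeSemigroup *-commutativeSemigroup
  using (x∙yz≈y∙xz; xy∙z≈y∙xz; xy∙z≈yz∙x)

half-double : ∀ y → half (y * 2) ≡ y
half-double zero = refl
half-double (suc y) = cong suc (half-double y)

half-≤ : ∀ n → half n ≤ n
half-≤ zero = z≤n
half-≤ (suc zero) = z≤n
half-≤ (suc (suc n)) = s≤s (m≤n⇒m≤1+n (half-≤ n))

[1+2y]%2≡1 : ∀ y → suc (y * 2) % 2 ≡ 1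
[1+2y]%2≡1 y = [m+kn]%n≡m%n 1 y 2

[1+n]%2≡1∸n%2 : ∀ n → suc n % 2 ≡ 1 ∸ n % 2
[1+n]%2≡1∸n%2 zero = refl
[1+n]%2≡1∸n%2 (suc zero) = refl
[1+n]%2≡1∸n%2 (suc (suc n)) = [1+n]%2≡1∸n%2 n

%2-differ⇔[m+n]%2≡1 : ∀ m n → (m % 2 ≢ n % 2) ⇔ ((m + n) % 2 ≡ 1)
%2-differ⇔[m+n]%2≡1 0 0 = mk⇔ (λ h → ⊥-elim (h refl)) (λ ())
%2-differ⇔[m+n]%2≡1 0 1 = mk⇔ (λ _ → refl) (λ _ ())
%2-differ⇔[m+n]%2≡1 1 0 = mk⇔ (λ _ → refl) (λ _ ())
%2-differ⇔[m+n]%2≡1 1 1 = mk⇔ (λ h → ⊥-elim (h refl)) (λ ())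
%2-differ⇔[m+n]%2≡1 0 (suc (suc n)) = %2-differ⇔[m+n]%2≡1 0 n
%2-differ⇔[m+n]%2≡1 1 (suc (suc n)) = %2-differ⇔[m+n]%2≡1 1 n
%2-differ⇔[m+n]%2≡1 (suc (suc m)) n = %2-differ⇔[m+n]%2≡1 m n

n%2≡0⇔[1+n]%2≡1 : ∀ n → (n % 2 ≡ 0) ⇔ (suc n % 2 ≡ 1)
n%2≡0⇔[1+n]%2≡1 0 = mk⇔ (λ _ → refl) (λ _ → refl)
n%2≡0⇔[1+n]%2≡1 1 = mk⇔ (λ ()) (λ ())
n%2≡0⇔[1+n]%2≡1 (suc (suc n)) = n%2≡0⇔[1+n]%2≡1 n

T-odd : ∀ z → T (suc (z * 2)) ≡ 2 + z * 3
T-odd z rewrite [1+2y]%2≡1 z = begin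
  half (3 * suc (z * 2) + 1) ≡⟨ cong half (3[1+2z]+1≡[2+3z]*2 z) ⟩
  half ((2 + z * 3) * 2)     ≡⟨ half-double (2 + z * 3) ⟩
  2 + z * 3                  ∎
  where
  open ≡-Reasoning
  3[1+2z]+1≡[2+3z]*2 : ∀ z → 3 * suc (z * 2) + 1 ≡ (2 + z * 3) * 2
  3[1+2z]+1≡[2+3z]*2 = solve-∀

T-succ : ∀ {x y} → x + 1 ≡ 2 * y → T x + 1 ≡ 3 * y
T-succ {x} {zero} x+1≡0 = ⊥-elim (1+n≢0 (trans (+-comm 1 x) x+1≡0))
T-succ {x} {suc z} x+1≡2[1+z] = begin
  T x + 1              ≡⟨ cong (λ t → T t + 1) x≡1+2z ⟩
  T (suc (z * 2)) + 1  ≡⟨ cong (_+ 1) (T-odd z) ⟩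
  2 + z * 3 + 1        ≡⟨ 2+3z+1≡3[1+z] z ⟩
  3 * suc z            ∎
  where
  open ≡-Reasoning
  2[1+z]≡1+2z+1 : ∀ z → 2 * suc z ≡ suc (z * 2) + 1
  2[1+z]≡1+2z+1 = solve-∀
  2+3z+1≡3[1+z] : ∀ z → 2 + z * 3 + 1 ≡ 3 * suc z
  2+3z+1≡3[1+z] = solve-∀
  x≡1+2z : x ≡ suc (z * 2)
  x≡1+2z = +-cancelʳ-≡ 1 x _ (trans x+1≡2[1+z] (2[1+z]≡1+2z+1 z))

iterT-succ : ∀ j {x} b → x + 1 ≡ 2 ^ j * b → iterT j x + 1 ≡ 3 ^ j * b
iterT-succ zero b x+1≡b = x+1≡b
iterT-succ (suc j) {x} b x+1≡2^[1+j]b = begin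
  T (iterT j x) + 1  ≡⟨ T-succ {y = 3 ^ j * b} iterT-j-x+1≡2[3^j*b] ⟩
  3 * (3 ^ j * b)    ≡⟨ *-assoc 3 (3 ^ j) b ⟨
  3 ^ suc j * b      ∎
  where
  open ≡-Reasoning
  iterT-j-x+1≡2[3^j*b] : iterT j x + 1 ≡ 2 * (3 ^ j * b)
  iterT-j-x+1≡2[3^j*b] =
    trans (iterT-succ j (2 * b) (trans x+1≡2^[1+j]b (xy∙z≈y∙xz 2 (2 ^ j) b)))
          (x∙yz≈y∙xz (3 ^ j) 2 b)

-- Induction on p absorbs one factor 3 into the odd cofactor: 3 (2q+1) = 2 (3q+1) + 1,
-- and 3q + 1 has the parity of q + 1.
[3^p[2q+1]∸1]%4 : ∀ p q {X} → X + 1 ≡ 3 ^ p * (2 * q + 1) → X % 4 ≡ (p + q) % 2 * 2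
[3^p[2q+1]∸1]%4 zero q {X} X+1≡2q+1 = begin
  X % 4      ≡⟨ cong (_% 4) (+-cancelʳ-≡ 1 X (q * 2) (trans X+1≡2q+1 (1*[2q+1]≡2q+1 q))) ⟩
  q * 2 % 4  ≡⟨ m%n*o≡m*o%[n*o] q 2 2 ⟨
  q % 2 * 2  ∎
  where
  open ≡-Reasoning
  1*[2q+1]≡2q+1 : ∀ q → 1 * (2 * q + 1) ≡ q * 2 + 1
  1*[2q+1]≡2q+1 = solve-∀
[3^p[2q+1]∸1]%4 (suc p) q {X} X+1≡3^[1+p][2q+1] = begin
  X % 4                        ≡⟨ [3^p[2q+1]∸1]%4 p (suc (q * 3)) X+1≡3^p[2[1+3q]+1] ⟩
  (p + suc (q * 3)) % 2 * 2    ≡⟨ cong (λ t → t % 2 * 2) (p+[1+3q]≡[1+p+q]+2q p q) ⟩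
  (suc p + q + q * 2) % 2 * 2  ≡⟨ cong (_* 2) ([m+kn]%n≡m%n (suc p + q) q 2) ⟩
  (suc p + q) % 2 * 2          ∎
  where
  open ≡-Reasoning
  3[2q+1]≡2[1+3q]+1 : ∀ q → 3 * (2 * q + 1) ≡ 2 * suc (q * 3) + 1
  3[2q+1]≡2[1+3q]+1 = solve-∀
  p+[1+3q]≡[1+p+q]+2q : ∀ p q → p + suc (q * 3) ≡ suc p + q + q * 2
  p+[1+3q]≡[1+p+q]+2q = solve-∀
  X+1≡3^p[2[1+3q]+1] : X + 1 ≡ 3 ^ p * (2 * suc (q * 3) + 1)
  X+1≡3^p[2[1+3q]+1] = begin
    X + 1                           ≡⟨ X+1≡3^[1+p][2q+1] ⟩
    3 * 3 ^ p * (2 * q + 1)         ≡⟨ xy∙z≈y∙xz 3 (3 ^ p) (2 * q + 1) ⟩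
    3 ^ p * (3 * (2 * q + 1))       ≡⟨ cong (3 ^ p *_) (3[2q+1]≡2[1+3q]+1 q) ⟩
    3 ^ p * (2 * suc (q * 3) + 1)   ∎

Cf-zero : ∀ f → Cf f 0 ≡ 0
Cf-zero zero = refl
Cf-zero (suc f) = refl

Cf-fuel-irrelevant : ∀ {f g} n → n ≤ f → n ≤ g → Cf f n ≡ Cf g n
Cf-fuel-irrelevant {f} {g} zero _ _ = trans (Cf-zero f) (sym (Cf-zero g))
Cf-fuel-irrelevant {suc f} {suc g} (suc zero) _ _ = refl
Cf-fuel-irrelevant {suc f} {suc g} (suc (suc k)) (s≤s k<f) (s≤s k<g) with k % 2
... | zero = cong (1 ∸_) (Cf-fuel-irrelevant (suc (half k))
                  (≤-trans (s≤s (half-≤ k)) k<f) (≤-trans (s≤s (half-≤ k)) k<g))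
... | suc _ = cong (1 ∸_) (Cf-fuel-irrelevant k (<⇒≤ k<f) (<⇒≤ k<g))

C-double : ∀ n .{{_ : NonZero n}} → C (n * 2) ≡ 1 ∸ C n
C-double (suc y) rewrite m*n%n≡0 y 2 {{_}} | half-double y =
  cong (1 ∸_) (Cf-fuel-irrelevant (suc y) (s≤s (m≤m*n y 2)) ≤-refl)

C-odd : ∀ q → C (suc (q * 2)) ≡ q % 2
C-odd zero = refl
C-odd (suc q) rewrite [1+2y]%2≡1 q = begin
  1 ∸ Cf (suc (suc (q * 2))) (suc (q * 2))
    ≡⟨ cong (1 ∸_) (Cf-fuel-irrelevant (suc (q * 2)) (n≤1+n _) ≤-refl) ⟩
  1 ∸ C (suc (q * 2))                        ≡⟨ cong (1 ∸_) (C-odd q) ⟩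
  1 ∸ q % 2                                  ≡⟨ [1+n]%2≡1∸n%2 q ⟨
  suc q % 2                                  ∎
  where open ≡-Reasoning

C[2^j*[2q+1]] : ∀ j q → C (2 ^ j * suc (q * 2)) ≡ (j + q) % 2
C[2^j*[2q+1]] zero q rewrite *-identityˡ (suc (q * 2)) = C-odd q
C[2^j*[2q+1]] (suc j) q = begin
  C (2 * 2 ^ j * suc (q * 2))  ≡⟨ cong C (xy∙z≈yz∙x 2 (2 ^ j) (suc (q * 2))) ⟩
  C (n * 2)                    ≡⟨ C-double n {{m*n≢0 (2 ^ j) _ {{m^n≢0 2 j}}}} ⟩
  1 ∸ C n                      ≡⟨ cong (1 ∸_) (C[2^j*[2q+1]] j q) ⟩
  1 ∸ (j + q) % 2              ≡⟨ [1+n]%2≡1∸n%2 (j + q) ⟨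
  suc (j + q) % 2              ∎
  where
  open ≡-Reasoning
  n : ℕ
  n = 2 ^ j * suc (q * 2)

T^p[m]%4≡2⇔%2-differ : ∀ p q {m} → m + 1 ≡ 2 ^ p * (2 * q + 1) →
                       (iterT p m % 4 ≡ 2) ⇔ (p % 2 ≢ q % 2)
T^p[m]%4≡2⇔%2-differ p q {m} m+1≡2^p[2q+1]
  rewrite [3^p[2q+1]∸1]%4 p q (iterT-succ p (2 * q + 1) m+1≡2^p[2q+1]) =
  ⇔-sym (%2-differ⇔[m+n]%2≡1 p q) ⇔-∘ mk⇔ (*-cancelʳ-≡ _ 1 2) (cong (_* 2))

%2-differ⇔C[2^p[2q+1]]≡0 : ∀ p q → (suc p % 2 ≢ q % 2) ⇔ (C (2 ^ p * suc (q * 2)) ≡ 0)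
%2-differ⇔C[2^p[2q+1]]≡0 p q rewrite C[2^j*[2q+1]] p q =
  ⇔-sym (n%2≡0⇔[1+n]%2≡1 (p + q)) ⇔-∘ %2-differ⇔[m+n]%2≡1 (suc p) q

corollary3p3 : (m n p q : ℕ) → n ≥ 2 → m + 1 ≡ 2 * n → p ≥ 1 →
    m + 1 ≡ 2 ^ p * (2 * q + 1) →
    ((iterT p m % 4 ≡ 2) ⇔ (p % 2 ≢ q % 2)) × ((p % 2 ≢ q % 2) ⇔ (C n ≡ 0))
corollary3p3 m n (suc p) q _ m+1≡2n (s≤s z≤n) m+1≡2^[1+p][2q+1] =
  T^p[m]%4≡2⇔%2-differ (suc p) q m+1≡2^[1+p][2q+1] ,
  subst (λ k → (suc p % 2 ≢ q % 2) ⇔ (C k ≡ 0)) (sym n≡2^p[2q+1])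
        (%2-differ⇔C[2^p[2q+1]]≡0 p q)
  where
  open ≡-Reasoning
  2q+1≡1+2q : 2 * q + 1 ≡ suc (q * 2)
  2q+1≡1+2q = trans (+-comm (2 * q) 1) (cong suc (*-comm 2 q))
  n≡2^p[2q+1] : n ≡ 2 ^ p * suc (q * 2)
  n≡2^p[2q+1] = *-cancelˡ-≡ n _ 2 (begin
    2 * n                          ≡⟨ m+1≡2n ⟨
    m + 1                          ≡⟨ m+1≡2^[1+p][2q+1] ⟩
    2 * 2 ^ p * (2 * q + 1)        ≡⟨ *-assoc 2 (2 ^ p) (2 * q + 1) ⟩
    2 * (2 ^ p * (2 * q + 1))      ≡⟨ cong (λ t → 2 * (2 ^ p * t)) 2q+1≡1+2q ⟩
    2 * (2 ^ p * suc (q * 2))      ∎)
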